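{- Let $p_1\neq p_2$ be primes and let $\leq_{\mathbf{K}_1}$ be the relation on $K_1$ defined in the context. Then $\leq_{\mathbf{K}_1}$ is transitive, and it satisfies coherence: if $G_0,G_1,G_2\in K_1$ with $G_0\leq_{\mathbf{K}_1}G_2$, $G_1\leq_{\mathbf{K}_1}G_2$ and $G_0\subseteq G_1$, then $G_0\leq_{\mathbf{K}_1}G_1$.
   Context: For a prime $p$ and an abelian group $G$, $p^\omega G:=\bigcap_{n<\omega}p^nG$; $G\leq_pH$ means $G$ is a pure subgroup of $H$ ($nG=G\cap nH$ for all $n\in\mathbb{Z}$). $K_1$ is the class of torsion-free abelian groups $G$ with $|p_1^\omega G|,|p_2^\omega G|\le\aleph_0$. For $G_1,G_2\in K_1$, $G_1\leq_{\mathbf{K}_1}G_2$ iff (a) $G_1\leq_pG_2$, (b) $p_1^\omega G_1=p_1^\omega G_2$, and (c) either $G_1=p_1^\omega G_1$ or $p_2^\omega G_1=p_2^\omega G_2$. -}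

module Defs where

open import Level using (Level; _⊔_; suc)
open import Algebra.Bundles using (AbelianGroup)
open import Data.Nat as ℕ using (ℕ; zero; _^_)
open import Data.Integer as ℤ using (ℤ; +_; -[1+_])
open import Data.Product using (Σ; ∃; ∃-syntax; _×_; _,_; proj₁)
open import Data.Sum using (_⊎_)
open import Relation.Binary.PropositionalEquality using (_≡_)
open import Relation.Nullary using (¬_)

-- Everything is done inside a fixed ambient abelian group A; the groups
-- G, H of the paper are subgroups of A (given by predicates).
module _ {c ℓ : Level} (A : AbelianGroup c ℓ) where
  open AbelianGroup A

  _·ℕ_ : ℕ → Carrier → Carrier
  zero ·ℕ x = ε
  ℕ.suc n ·ℕ x = x ∙ (n ·ℕ x)

  _·ℤ_ : ℤ → Carrier → Carrier
  (+ n) ·ℤ x = n ·ℕ x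
  -[1+ n ] ·ℤ x = (ℕ.suc n ·ℕ x) ⁻¹

  record Subgroup (a : Level) : Set (c ⊔ ℓ ⊔ suc a) where
    field
      _∈_    : Carrier → Set a
      ∈-resp : ∀ {x y} → x ≈ y → _∈_ x → _∈_ y
      ε∈     : _∈_ ε
      ∙∈     : ∀ {x y} → _∈_ x → _∈_ y → _∈_ (x ∙ y)
      ⁻¹∈    : ∀ {x} → _∈_ x → _∈_ (x ⁻¹)
  open Subgroup public

  Subset : (a : Level) → Set (c ⊔ suc a)
  Subset a = Carrier → Set a

  _⊆_ : ∀ {a b} → Subset a → Subset b → Set (c ⊔ a ⊔ b)
  S ⊆ T = ∀ x → S x → T x

  _≐_ : ∀ {a b} → Subset a → Subset b → Set (c ⊔ a ⊔ b)
  S ≐ T = (S ⊆ T) × (T ⊆ S)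

  _∩_ : ∀ {a b} → Subset a → Subset b → Subset (a ⊔ b)
  (S ∩ T) x = S x × T x

  mulℤ : ∀ {a} → ℤ → Subgroup a → Subset (c ⊔ ℓ ⊔ a)
  mulℤ n G x = ∃[ y ] (_∈_ G y × x ≈ n ·ℤ y)

  omega : ∀ {a} → ℕ → Subgroup a → Subset (c ⊔ ℓ ⊔ a)
  omega p G x = ∀ (n : ℕ) → ∃[ y ] (_∈_ G y × x ≈ (p ^ n) ·ℕ y)

  TorsionFree : ∀ {a} → Subgroup a → Set (c ⊔ ℓ ⊔ a)
  TorsionFree G = ∀ (n : ℕ) (x : Carrier) → _∈_ G x → ¬ (n ≡ 0) → n ·ℕ x ≈ ε → x ≈ ε

  AtMostCountable : ∀ {a} → Subset a → Set (c ⊔ ℓ ⊔ a)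
  AtMostCountable S =
    Σ (Σ Carrier S → ℕ) λ f → ∀ (u v : Σ Carrier S) → f u ≡ f v → proj₁ u ≈ proj₁ v

  _≤p_ : ∀ {a b} → Subgroup a → Subgroup b → Set (c ⊔ ℓ ⊔ a ⊔ b)
  G ≤p H = (_∈_ G ⊆ _∈_ H) × (∀ (n : ℤ) → mulℤ n G ≐ (_∈_ G ∩ mulℤ n H))

  K₁ : ∀ {a} → ℕ → ℕ → Subgroup a → Set (c ⊔ ℓ ⊔ a)
  K₁ p₁ p₂ G = TorsionFree G × AtMostCountable (omega p₁ G) × AtMostCountable (omega p₂ G)

  ≤K₁ : ∀ {a b} → ℕ → ℕ → Subgroup a → Subgroup b → Set (c ⊔ ℓ ⊔ a ⊔ b)
  ≤K₁ p₁ p₂ G H =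
    (G ≤p H) × (omega p₁ G ≐ omega p₁ H)
    × ((_∈_ G ≐ omega p₁ G) ⊎ (omega p₂ G ≐ omega p₂ H))

{-# OPTIONS --safe #-}
module Submission where

open import Defs
open import Level using (Level)
open import Algebra.Bundles using (AbelianGroup)
open import Data.Nat using (ℕ; zero; suc)
open import Data.Nat.Primality using (Prime)
open import Data.Integer using (+_; -[1+_])
open import Data.Product using (_×_; _,_; proj₁; proj₂)
open import Data.Sum using (_⊎_; inj₁; inj₂)
open import Relation.Binary.PropositionalEquality using (_≢_)
open import Function using (_∘′_)

-- Both properties are formal: purity is transitive and coherent, and G ↦ p^ω G
-- is monotone with p^ω G ⊆ G.  The one case needing thought is transitivity when G₁ ≤ G₂ holds via
-- p₂^ω G₁ = p₂^ω G₂ and G₂ ≤ G₃ via G₂ = p₁^ω G₂: then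
-- G₁ ⊆ G₂ = p₁^ω G₂ = p₁^ω G₁, so G₁ = p₁^ω G₁.

module _ {c ℓ : Level} (A : AbelianGroup c ℓ) where
  open AbelianGroup A using (sym)

  ⊆-trans : ∀ {a b d} {S : Subset A a} {T : Subset A b} {U : Subset A d} →
    _⊆_ A S T → _⊆_ A T U → _⊆_ A S U
  ⊆-trans S⊆T T⊆U x = T⊆U x ∘′ S⊆T x

  module _ {a b d : Level} {S : Subset A a} {T : Subset A b} {U : Subset A d} where

    ≐-trans : _≐_ A S T → _≐_ A T U → _≐_ A S U
    ≐-trans (S⊆T , T⊆S) (T⊆U , U⊆T) = ⊆-trans S⊆T T⊆U , ⊆-trans U⊆T T⊆S

    ≐-sandwich : _⊆_ A S T → _⊆_ A T U → _≐_ A S U → _≐_ A S T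
    ≐-sandwich S⊆T T⊆U (_ , U⊆S) = S⊆T , ⊆-trans T⊆U U⊆S

  ≐-sym : ∀ {a b} {S : Subset A a} {T : Subset A b} → _≐_ A S T → _≐_ A T S
  ≐-sym (S⊆T , T⊆S) = T⊆S , S⊆T

  module _ {a : Level} (G : Subgroup A a) where

    ·ℕ-closed : ∀ n {x} → _∈_ G x → _∈_ G (_·ℕ_ A n x)
    ·ℕ-closed zero    x∈G = ε∈ G
    ·ℕ-closed (suc n) x∈G = ∙∈ G x∈G (·ℕ-closed n x∈G)

    ·ℤ-closed : ∀ n {x} → _∈_ G x → _∈_ G (_·ℤ_ A n x)
    ·ℤ-closed (+ n)    x∈G = ·ℕ-closed n x∈G
    ·ℤ-closed -[1+ n ] x∈G = ⁻¹∈ G (·ℕ-closed (suc n) x∈G)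

    mulℤ⊆ : ∀ n → _⊆_ A (mulℤ A n G) (_∈_ G)
    mulℤ⊆ n x (y , y∈G , x≈ny) = ∈-resp G (sym x≈ny) (·ℤ-closed n y∈G)

    omega⊆ : ∀ p → _⊆_ A (omega A p G) (_∈_ G)
    omega⊆ p x x∈pωG with x∈pωG 0
    ... | y , y∈G , x≈y∙ε = ∈-resp G (sym x≈y∙ε) (∙∈ G y∈G (ε∈ G))

  module _ {a b : Level} (G : Subgroup A a) (H : Subgroup A b) where

    mulℤ-mono : _⊆_ A (_∈_ G) (_∈_ H) → ∀ n → _⊆_ A (mulℤ A n G) (mulℤ A n H)
    mulℤ-mono G⊆H n x (y , y∈G , x≈ny) = y , G⊆H y y∈G , x≈ny

    omega-mono : _⊆_ A (_∈_ G) (_∈_ H) → ∀ p → _⊆_ A (omega A p G) (omega A p H)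
    omega-mono G⊆H p x x∈pωG n with x∈pωG n
    ... | y , y∈G , x≈pⁿy = y , G⊆H y y∈G , x≈pⁿy

    omega-fixed-descends : _⊆_ A (_∈_ G) (_∈_ H) → ∀ p → _≐_ A (omega A p G) (omega A p H) →
      _≐_ A (_∈_ H) (omega A p H) → _≐_ A (_∈_ G) (omega A p G)
    omega-fixed-descends G⊆H p (_ , pωH⊆pωG) (H⊆pωH , _) =
      ⊆-trans G⊆H (⊆-trans H⊆pωH pωH⊆pωG) , omega⊆ G p

  module _ {a b d : Level} {G : Subgroup A a} {H : Subgroup A b} {K : Subgroup A d} where

    ≤p-trans : _≤p_ A G H → _≤p_ A H K → _≤p_ A G K
    ≤p-trans (G⊆H , G-pure) (H⊆K , H-pure) = ⊆-trans G⊆H H⊆K , K-pure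
      where
      K-pure : ∀ n → _≐_ A (mulℤ A n G) (_∩_ A (_∈_ G) (mulℤ A n K))
      K-pure n = (λ x x∈nG → mulℤ⊆ G n x x∈nG , mulℤ-mono G K (⊆-trans G⊆H H⊆K) n x x∈nG)
               , (λ x (x∈G , x∈nK) →
                    proj₂ (G-pure n) x (x∈G , proj₂ (H-pure n) x (G⊆H x x∈G , x∈nK)))

    ≤p-coherent : _≤p_ A G K → _⊆_ A (_∈_ H) (_∈_ K) → _⊆_ A (_∈_ G) (_∈_ H) → _≤p_ A G H
    ≤p-coherent (_ , G-pure) H⊆K G⊆H = G⊆H , H-pure
      where
      H-pure : ∀ n → _≐_ A (mulℤ A n G) (_∩_ A (_∈_ G) (mulℤ A n H))
      H-pure n = (λ x x∈nG → mulℤ⊆ G n x x∈nG , mulℤ-mono G H G⊆H n x x∈nG)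
               , (λ x (x∈G , x∈nH) → proj₂ (G-pure n) x (x∈G , mulℤ-mono H K H⊆K n x x∈nH))

    ≤K₁-trans : ∀ p₁ p₂ → ≤K₁ A p₁ p₂ G H → ≤K₁ A p₁ p₂ H K → ≤K₁ A p₁ p₂ G K
    ≤K₁-trans p₁ p₂ (G≤pH , ωGH , cGH) (H≤pK , ωHK , cHK) =
      ≤p-trans G≤pH H≤pK , ≐-trans ωGH ωHK , condition-c cGH cHK
      where
      condition-c : (_≐_ A (_∈_ G) (omega A p₁ G)) ⊎ (_≐_ A (omega A p₂ G) (omega A p₂ H)) →
                    (_≐_ A (_∈_ H) (omega A p₁ H)) ⊎ (_≐_ A (omega A p₂ H) (omega A p₂ K)) →
                    (_≐_ A (_∈_ G) (omega A p₁ G)) ⊎ (_≐_ A (omega A p₂ G) (omega A p₂ K))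
      condition-c (inj₁ G-fixed) _           = inj₁ G-fixed
      condition-c (inj₂ ω₂GH)    (inj₂ ω₂HK) = inj₂ (≐-trans ω₂GH ω₂HK)
      condition-c (inj₂ _)       (inj₁ H-fixed) =
        inj₁ (omega-fixed-descends G H (proj₁ G≤pH) p₁ ωGH H-fixed)

    ≤K₁-coherent : ∀ p₁ p₂ → ≤K₁ A p₁ p₂ G K → ≤K₁ A p₁ p₂ H K →
      _⊆_ A (_∈_ G) (_∈_ H) → ≤K₁ A p₁ p₂ G H
    ≤K₁-coherent p₁ p₂ (G≤pK , ωGK , cGK) (H≤pK , ωHK , _) G⊆H =
      ≤p-coherent G≤pK (proj₁ H≤pK) G⊆H , ≐-trans ωGK (≐-sym ωHK) , condition-c cGK
      where
      condition-c : (_≐_ A (_∈_ G) (omega A p₁ G)) ⊎ (_≐_ A (omega A p₂ G) (omega A p₂ K)) →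
                    (_≐_ A (_∈_ G) (omega A p₁ G)) ⊎ (_≐_ A (omega A p₂ G) (omega A p₂ H))
      condition-c (inj₁ G-fixed) = inj₁ G-fixed
      condition-c (inj₂ ω₂GK)    =
        inj₂ (≐-sandwich (omega-mono G H G⊆H p₂) (omega-mono H K (proj₁ H≤pK) p₂) ω₂GK)

proposition3p4 : ∀ {c ℓ a} (p₁ p₂ : ℕ) → Prime p₁ → Prime p₂ → p₁ ≢ p₂ →
    ((A : AbelianGroup c ℓ) (G₁ G₂ G₃ : Subgroup A a) →
      K₁ A p₁ p₂ G₁ → K₁ A p₁ p₂ G₂ → K₁ A p₁ p₂ G₃ →
      ≤K₁ A p₁ p₂ G₁ G₂ → ≤K₁ A p₁ p₂ G₂ G₃ → ≤K₁ A p₁ p₂ G₁ G₃)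
    × ((A : AbelianGroup c ℓ) (G₀ G₁ G₂ : Subgroup A a) →
      K₁ A p₁ p₂ G₀ → K₁ A p₁ p₂ G₁ → K₁ A p₁ p₂ G₂ →
      ≤K₁ A p₁ p₂ G₀ G₂ → ≤K₁ A p₁ p₂ G₁ G₂ → _⊆_ A (_∈_ G₀) (_∈_ G₁) →
      ≤K₁ A p₁ p₂ G₀ G₁)
proposition3p4 p₁ p₂ _ _ _ =
  (λ A G₁ G₂ G₃ _ _ _ → ≤K₁-trans A {G = G₁} {G₂} {G₃} p₁ p₂)
  , (λ A G₀ G₁ G₂ _ _ _ → ≤K₁-coherent A {G = G₀} {G₁} {G₂} p₁ p₂)
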